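{- For every integer $m\ge 0$, $$S_m(x,y,z)=\sum_{T\in\mathcal{T}_m}x^{\mathsf{ee}(T)}y^{\mathsf{oe}(T)}z^{\mathsf{odd}(T)}.$$ Equivalently, writing $S_{2m}(x,y,z)=\sum_{i,j\ge0}s_{2m,i,j}\,x^{2i+1}y^{2j}z^{2m-2i-2j}$ and $S_{2m+1}(x,y,z)=\sum_{i,j\ge0}s_{2m+1,i,j}\,x^{2i}y^{2j+1}z^{2m+1-2i-2j}$, the coefficient $s_{m,i,j}$ equals the number of trees $T\in\mathcal{T}_m$ with $\lfloor\mathsf{ee}(T)/2\rfloor=i$ and $\lfloor\mathsf{oe}(T)/2\rfloor=j$.
   Context: Let $D$ be the derivation on the polynomial ring $\mathbb{Z}[x,y,z]$ (linear and satisfying $D(uv)=D(u)v+uD(v)$) determined by $D(x)=yz$, $D(y)=xz$, $D(z)=xy$. The $m$-th Schett polynomial is $S_m(x,y,z)=D^m(x)$. $\mathcal{T}_m$ denotes the set of increasing trees on $\{1,\dots,m\}$: plane trees (rooted trees whose children at each node are linearly ordered left to right) with $m+1$ nodes labeled bijectively by $0,1,\dots,m$ such that labels increase along every root-to-leaf path and the labels of the children of each node increase from left to right. The degree of a node is its number of children; the level of a node is its distance from the root (root at level $0$). $\mathsf{ee}(T)$ is the number of even-degree nodes on even levels, $\mathsf{oe}(T)$ the number of even-degree nodes on odd levels, and $\mathsf{odd}(T)$ the number of odd-degree nodes of $T$. -}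

module Defs where

open import Data.Nat using (ℕ; zero; suc; _∸_; _<ᵇ_; _≡ᵇ_)
open import Data.Nat.Properties using ()
open import Data.Integer using (ℤ; +_) renaming (_+_ to _+ℤ_; _*_ to _*ℤ_)
open import Data.Bool using (Bool; true; false; _∧_; not; if_then_else_)
open import Data.List using (List; []; _∷_; _++_; length; upTo; concatMap)
open import Data.Product using (_×_; _,_)
open import Function using (_∘_)

-- Polynomials in ℤ[x,y,z], represented as formal sums of monomials.
-- A term (k , a , b , c) stands for k · x^a y^b z^c.

Monomial : Set
Monomial = ℤ × ℕ × ℕ × ℕ

Poly : Set
Poly = List Monomial

coeff : Poly → ℕ → ℕ → ℕ → ℤ
coeff [] a b c = + 0
coeff ((k , a' , b' , c') ∷ p) a b c =
  (if (a' ≡ᵇ a) ∧ (b' ≡ᵇ b) ∧ (c' ≡ᵇ c) then k else + 0) +ℤ coeff p a b c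

-- The derivation D with D x = yz, D y = xz, D z = xy, applied to a monomial
-- via the Leibniz rule:
-- D(k x^a y^b z^c) = k a x^(a-1) y^(b+1) z^(c+1)
--                  + k b x^(a+1) y^(b-1) z^(c+1)
--                  + k c x^(a+1) y^(b+1) z^(c-1)
-- (terms with a zero exponent factor have coefficient 0).
Dmono : Monomial → Poly
Dmono (k , a , b , c) =
    (k *ℤ + a , a ∸ 1 , suc b , suc c)
  ∷ (k *ℤ + b , suc a , b ∸ 1 , suc c)
  ∷ (k *ℤ + c , suc a , suc b , c ∸ 1)
  ∷ []

D : Poly → Poly
D = concatMap Dmono

iter : ℕ → (Poly → Poly) → Poly → Poly
iter zero f p = p
iter (suc n) f p = f (iter n f p)

xPoly : Poly
xPoly = (+ 1 , 1 , 0 , 0) ∷ []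

S : ℕ → Poly
S m = iter m D xPoly

data Tree : Set where
  node : ℕ → List Tree → Tree

label : Tree → ℕ
label (node l _) = l

mutual
  labels : Tree → List ℕ
  labels (node l ts) = l ∷ labelsF ts

  labelsF : List Tree → List ℕ
  labelsF [] = []
  labelsF (t ∷ ts) = labels t ++ labelsF ts

childrenAbove : ℕ → List Tree → Bool
childrenAbove l [] = true
childrenAbove l (t ∷ ts) = (l <ᵇ label t) ∧ childrenAbove l ts

increasingLabels : List Tree → Bool
increasingLabels [] = true
increasingLabels (t ∷ []) = true
increasingLabels (t ∷ u ∷ ts) = (label t <ᵇ label u) ∧ increasingLabels (u ∷ ts)

mutual
  increasingTree : Tree → Bool
  increasingTree (node l ts) =
    childrenAbove l ts ∧ increasingLabels ts ∧ increasingForest ts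

  increasingForest : List Tree → Bool
  increasingForest [] = true
  increasingForest (t ∷ ts) = increasingTree t ∧ increasingForest ts

allB : (ℕ → Bool) → List ℕ → Bool
allB p [] = true
allB p (x ∷ xs) = p x ∧ allB p xs

countℕ : ℕ → List ℕ → ℕ
countℕ n [] = 0
countℕ n (x ∷ xs) = if n ≡ᵇ x then suc (countℕ n xs) else countℕ n xs

labelsBijective : ℕ → Tree → Bool
labelsBijective m t =
  (length (labels t) ≡ᵇ suc m) ∧ allB (λ i → countℕ i (labels t) ≡ᵇ 1) (upTo (suc m))

-- T is an increasing tree on {1,…,m} (member of 𝒯_m)
isIncTree : ℕ → Tree → Bool
isIncTree m t = labelsBijective m t ∧ increasingTree t

even? : ℕ → Bool
even? zero = true
even? (suc n) = not (even? n)

b2n : Bool → ℕ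
b2n true = 1
b2n false = 0

open import Data.Nat using (_+_)

mutual
  -- number of even-degree nodes on levels of parity given (relative to
  -- the current node being on a level of parity `ev`), i.e.
  -- eeAt ev t counts even-degree nodes whose level parity agrees with
  -- "current node on even level iff ev".
  evenDegOnEven : Bool → Tree → ℕ
  evenDegOnEven ev (node l ts) =
    b2n (ev ∧ even? (length ts)) + evenDegOnEvenF (not ev) ts

  evenDegOnEvenF : Bool → List Tree → ℕ
  evenDegOnEvenF ev [] = 0
  evenDegOnEvenF ev (t ∷ ts) = evenDegOnEven ev t + evenDegOnEvenF ev ts

-- even-degree nodes on even levels (root at level 0)
ee : Tree → ℕ
ee = evenDegOnEven true

oe : Tree → ℕ
oe = evenDegOnEven false

mutual
  oddDeg : Tree → ℕ
  oddDeg (node l ts) = b2n (not (even? (length ts))) + oddDegF ts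

  oddDegF : List Tree → ℕ
  oddDegF [] = 0
  oddDegF (t ∷ ts) = oddDeg t + oddDegF ts

odd : Tree → ℕ
odd = oddDeg

-- Every tree of 𝒯_{m+1} arises from exactly one tree of 𝒯_m by attaching the leaf m+1 as
-- the rightmost child of one of its nodes; removing the maximal leaf undoes this.  Give a
-- node the variable x (even degree, even level), y (even degree, odd level) or z (odd
-- degree), so that a tree has monomial x^ee y^oe z^odd.  Attaching the leaf to an x-node
-- makes it a z-node and adds a y-leaf, x ↦ yz; likewise y ↦ xz and z ↦ xy.  So the
-- monomials of the trees grown from T are the terms of D applied to the monomial of T, one
-- per node, and the generating polynomial of 𝒯_m obeys the recursion S_{m+1} = D S_m.

module Submission where

open import Defs
open import Data.Bool using (Bool; true; false; _∧_; not; if_then_else_; T)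
open import Data.Bool.Properties using (T-∧; T-≡; T-irrelevant; ¬-not; ∧-assoc; ∧-zeroʳ)
open import Data.Empty using (⊥-elim)
open import Data.List using (List; []; _∷_; _++_; [_]; length; upTo; map; concatMap; filter; lookup)
open import Data.List.Properties
  using (upTo-∷ʳ; length-upTo; length-++; map-++; ++-assoc; ++-identityʳ; ∷-injectiveˡ; ∷-injectiveʳ;
         map-∘; map-cong; map-cong-local; concatMap-map; map-concatMap)
open import Data.List.Membership.Propositional using (_∈_; _∉_; find; lose)
open import Data.List.Membership.Propositional.Properties
  using (∈-++⁺ˡ; ∈-++⁺ʳ; ∈-++⁻; ∈-map⁺; ∈-map⁻; ∈-upTo⁺; ∈-upTo⁻; ∈-concatMap⁺; ∈-concatMap⁻;
         ∈-filter⁺; ∈-filter⁻; ∈-lookup)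
open import Data.List.Membership.Propositional.Properties.WithK using (unique⇒irrelevant)
open import Data.List.Relation.Binary.Permutation.Propositional
  using (_↭_; ↭-refl; ↭-sym; ↭-trans; prep; swap)
  renaming (refl to ↭-refl′; trans to ↭-trans′)
open import Data.List.Relation.Binary.Permutation.Propositional.Properties
  using (∷↭∷ʳ; ↭-length; ∈-resp-↭; drop-∷; shift; ++⁺ˡ; ++⁺ʳ; ↭-singleton-inv)
open import Data.List.Relation.Unary.Any using (here; there; index)
open import Data.List.Relation.Unary.Any.Properties using (lookup-index)
import Data.List.Relation.Unary.All as All
import Data.List.Relation.Unary.AllPairs as AllPairs
open import Data.List.Relation.Unary.Unique.Propositional using (Unique)
import Data.List.Relation.Unary.Unique.Propositional.Properties as UP
open import Data.Nat using (ℕ; zero; suc; _+_; _*_; _∸_; _<_; _≤_; _≡ᵇ_; _<ᵇ_; s≤s⁻¹)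
open import Data.Nat.Properties
open import Data.Nat.ListAction using (sum)
open import Data.Nat.ListAction.Properties using (sum-++)
open import Data.Nat.Tactic.RingSolver using (solve-∀)
open import Data.Product using (Σ; ∃; _×_; _,_; proj₁; proj₂)
import Data.Product as Prod
open import Data.Sum using (_⊎_; inj₁; inj₂)
open import Function using (_∘_; id; case_of_)
open import Function.Bundles using (_⇔_; mk⇔; Equivalence; _↔_; mk↔ₛ′)
open import Relation.Binary.PropositionalEquality hiding ([_])
open import Relation.Nullary using (¬_; Dec; yes; no; Irrelevant)
open import Relation.Nullary.Decidable using (T?)
open import Data.Fin using (Fin)
import Data.Fin as Fin

open Equivalence using (to; from)

-- Permutations of 0, 1, …, k − 1

≡ᵇ-true : ∀ {m n} → m ≡ n → (m ≡ᵇ n) ≡ true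
≡ᵇ-true {m} refl = to T-≡ (≡⇒≡ᵇ m m refl)

≡ᵇ-false : ∀ {m n} → m ≢ n → (m ≡ᵇ n) ≡ false
≡ᵇ-false {m} {n} m≢n = ¬-not (m≢n ∘ ≡ᵇ⇒≡ m n ∘ from T-≡)

countℕ-hit : ∀ n xs → countℕ n (n ∷ xs) ≡ suc (countℕ n xs)
countℕ-hit n xs rewrite ≡ᵇ-true {n} refl = refl

countℕ-miss : ∀ {n x} xs → n ≢ x → countℕ n (x ∷ xs) ≡ countℕ n xs
countℕ-miss xs n≢x rewrite ≡ᵇ-false n≢x = refl

countℕ-++ : ∀ n xs ys → countℕ n (xs ++ ys) ≡ countℕ n xs + countℕ n ys
countℕ-++ n [] ys = refl
countℕ-++ n (x ∷ xs) ys with n ≡ᵇ x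
... | true = cong suc (countℕ-++ n xs ys)
... | false = countℕ-++ n xs ys

countℕ-↭ : ∀ n {xs ys} → xs ↭ ys → countℕ n xs ≡ countℕ n ys
countℕ-↭ n ↭-refl′ = refl
countℕ-↭ n (prep x p) with n ≡ᵇ x
... | true = cong suc (countℕ-↭ n p)
... | false = countℕ-↭ n p
countℕ-↭ n (swap x y p) with n ≡ᵇ x | n ≡ᵇ y
... | true | true = cong (suc ∘ suc) (countℕ-↭ n p)
... | true | false = cong suc (countℕ-↭ n p)
... | false | true = cong suc (countℕ-↭ n p)
... | false | false = countℕ-↭ n p
countℕ-↭ n (↭-trans′ p q) = trans (countℕ-↭ n p) (countℕ-↭ n q)

countℕ≡0⇒∉ : ∀ {n xs} → countℕ n xs ≡ 0 → n ∉ xs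
countℕ≡0⇒∉ {n} {x ∷ xs} c≡0 (here refl) with () ← trans (sym (countℕ-hit n xs)) c≡0
countℕ≡0⇒∉ {n} {x ∷ xs} c≡0 (there n∈xs) with n ≡ᵇ x
... | false = countℕ≡0⇒∉ c≡0 n∈xs

countℕ≡suc⇒↭ : ∀ {n c} xs → countℕ n xs ≡ suc c → ∃ λ ys → xs ↭ n ∷ ys
countℕ≡suc⇒↭ {n} (x ∷ xs) c≡s with n ≟ x
... | yes refl = xs , ↭-refl
... | no n≢x with ys , p ← countℕ≡suc⇒↭ xs (trans (sym (countℕ-miss xs n≢x)) c≡s)
  = x ∷ ys , ↭-trans (prep x p) (swap x n ↭-refl)

upTo-suc-↭ : ∀ k → upTo (suc k) ↭ k ∷ upTo k
upTo-suc-↭ k = subst (_↭ k ∷ upTo k) (upTo-∷ʳ k) (↭-sym (∷↭∷ʳ k (upTo k)))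

countℕ-upTo-≥ : ∀ {i} k → k ≤ i → countℕ i (upTo k) ≡ 0
countℕ-upTo-≥ zero k≤i = refl
countℕ-upTo-≥ {i} (suc k) k<i = begin
  countℕ i (upTo (suc k)) ≡⟨ countℕ-↭ i (upTo-suc-↭ k) ⟩
  countℕ i (k ∷ upTo k)   ≡⟨ countℕ-miss (upTo k) (>⇒≢ k<i) ⟩
  countℕ i (upTo k)       ≡⟨ countℕ-upTo-≥ k (<⇒≤ k<i) ⟩
  0                       ∎
  where open ≡-Reasoning

countℕ-upTo-< : ∀ {i} k → i < k → countℕ i (upTo k) ≡ 1
countℕ-upTo-< {i} (suc k) i<1+k = trans (countℕ-↭ i (upTo-suc-↭ k)) (last (i ≟ k))
  where
  last : Dec (i ≡ k) → countℕ i (k ∷ upTo k) ≡ 1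
  last (yes refl) = trans (countℕ-hit i (upTo i)) (cong suc (countℕ-upTo-≥ i ≤-refl))
  last (no i≢k) = trans (countℕ-miss (upTo k) i≢k) (countℕ-upTo-< k (≤∧≢⇒< (s≤s⁻¹ i<1+k) i≢k))

↭-upTo : ∀ k xs → length xs ≡ k → (∀ i → i < k → countℕ i xs ≡ 1) → xs ↭ upTo k
↭-upTo zero [] _ _ = ↭-refl
↭-upTo (suc k) xs len≡ once with ys , xs↭ ← countℕ≡suc⇒↭ xs (once k ≤-refl) =
  ↭-trans xs↭ (↭-trans (prep k (↭-upTo k ys len′ once′)) (↭-sym (upTo-suc-↭ k)))
  where
  len′ : length ys ≡ k
  len′ = suc-injective (trans (sym (↭-length xs↭)) len≡)
  once′ : ∀ i → i < k → countℕ i ys ≡ 1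
  once′ i i<k = begin
    countℕ i ys       ≡⟨ sym (countℕ-miss ys (<⇒≢ i<k)) ⟩
    countℕ i (k ∷ ys) ≡⟨ sym (countℕ-↭ i xs↭) ⟩
    countℕ i xs       ≡⟨ once i (m<n⇒m<1+n i<k) ⟩
    1                 ∎
    where open ≡-Reasoning

allB⇔All : ∀ (p : ℕ → Bool) xs → T (allB p xs) ⇔ (∀ {x} → x ∈ xs → T (p x))
allB⇔All p [] = mk⇔ (λ _ ()) _
allB⇔All p (x ∷ xs) = mk⇔
  (λ h → let px , pxs = to T-∧ h in λ { (here refl) → px ; (there x∈) → to (allB⇔All p xs) pxs x∈ })
  (λ h → from T-∧ (h (here refl) , from (allB⇔All p xs) (λ x∈ → h (there x∈))))

labelsBijective⇔ : ∀ m t → T (labelsBijective m t) ⇔ (labels t ↭ upTo (suc m))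
labelsBijective⇔ m t = mk⇔ ⇒ ⇐
  where
  once? : ℕ → Bool
  once? i = countℕ i (labels t) ≡ᵇ 1
  ⇒ : T (labelsBijective m t) → labels t ↭ upTo (suc m)
  ⇒ h with len , once ← to T-∧ h = ↭-upTo (suc m) (labels t) (≡ᵇ⇒≡ _ _ len)
    (λ i i<k → ≡ᵇ⇒≡ _ _ (to (allB⇔All once? (upTo (suc m))) once (∈-upTo⁺ i<k)))
  ⇐ : labels t ↭ upTo (suc m) → T (labelsBijective m t)
  ⇐ p = from T-∧
    ( ≡⇒≡ᵇ _ _ (trans (↭-length p) (length-upTo (suc m)))
    , from (allB⇔All once? (upTo (suc m)))
        (λ {i} i∈ → ≡⇒≡ᵇ _ _ (trans (countℕ-↭ i p) (countℕ-upTo-< (suc m) (∈-upTo⁻ i∈)))))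

-- Growing a tree by a new maximal leaf

data Var : Set where
  X Y Z : Var

swapXY : Var → Var
swapXY X = Y
swapXY Y = X
swapXY Z = Z

-- the variable contributed by a node of the given degree parity on an even level
degreeVar : Bool → Var
degreeVar true = X
degreeVar false = Z

leaf : ℕ → Tree
leaf n = node n []

-- Grown n v t g: g is t with the leaf n attached as last child of a node whose variable is v,
-- levels being counted from the root of t.
mutual
  data Grown (n : ℕ) : Var → Tree → Tree → Set where
    here : ∀ {l ts} → Grown n (degreeVar (even? (length ts))) (node l ts) (node l (ts ++ [ leaf n ]))
    there : ∀ {v l ts gs} → GrownF n v ts gs → Grown n (swapXY v) (node l ts) (node l gs)

  data GrownF (n : ℕ) : Var → List Tree → List Tree → Set where
    head : ∀ {v c g cs} → Grown n v c g → GrownF n v (c ∷ cs) (g ∷ cs)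
    tail : ∀ {v c cs gs} → GrownF n v cs gs → GrownF n v (c ∷ cs) (c ∷ gs)

mutual
  sites : ℕ → Tree → List (Var × Tree)
  sites n (node l ts) =
    (degreeVar (even? (length ts)) , node l (ts ++ [ leaf n ])) ∷ map (Prod.map swapXY (node l)) (sitesF n ts)

  sitesF : ℕ → List Tree → List (Var × List Tree)
  sitesF n [] = []
  sitesF n (c ∷ cs) = map (Prod.map₂ (_∷ cs)) (sites n c) ++ map (Prod.map₂ (c ∷_)) (sitesF n cs)

mutual
  ∈-sites⁻ : ∀ {n v g} t → (v , g) ∈ sites n t → Grown n v t g
  ∈-sites⁻ (node l ts) (here refl) = here
  ∈-sites⁻ (node l ts) (there v,g∈) with (v , gs) , v,gs∈ , refl ← ∈-map⁻ (Prod.map swapXY (node l)) v,g∈ =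
    there (∈-sitesF⁻ ts v,gs∈)

  ∈-sitesF⁻ : ∀ {n v gs} ts → (v , gs) ∈ sitesF n ts → GrownF n v ts gs
  ∈-sitesF⁻ (c ∷ cs) v,gs∈ with ∈-++⁻ (map (Prod.map₂ (_∷ cs)) (sites _ c)) v,gs∈
  ... | inj₁ v,gs∈ˡ with (v , g) , v,g∈ , refl ← ∈-map⁻ (Prod.map₂ (_∷ cs)) v,gs∈ˡ = head (∈-sites⁻ c v,g∈)
  ... | inj₂ v,gs∈ʳ with (v , gs) , v,gs∈ , refl ← ∈-map⁻ (Prod.map₂ (c ∷_)) v,gs∈ʳ = tail (∈-sitesF⁻ cs v,gs∈)

mutual
  ∈-sites⁺ : ∀ {n v t g} → Grown n v t g → (v , g) ∈ sites n t
  ∈-sites⁺ here = here refl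
  ∈-sites⁺ (there {l = l} G) = there (∈-map⁺ (Prod.map swapXY (node l)) (∈-sitesF⁺ G))

  ∈-sitesF⁺ : ∀ {n v ts gs} → GrownF n v ts gs → (v , gs) ∈ sitesF n ts
  ∈-sitesF⁺ (head {cs = cs} G) = ∈-++⁺ˡ (∈-map⁺ (Prod.map₂ (_∷ cs)) (∈-sites⁺ G))
  ∈-sitesF⁺ {n} (tail {c = c} {cs} G) =
    ∈-++⁺ʳ (map (Prod.map₂ (_∷ cs)) (sites n c)) (∈-map⁺ (Prod.map₂ (c ∷_)) (∈-sitesF⁺ G))

grow : ℕ → Tree → List Tree
grow n t = map proj₂ (sites n t)

trees : ℕ → List Tree
trees zero = [ leaf 0 ]
trees (suc m) = concatMap (grow (suc m)) (trees m)

labelsF-++ : ∀ xs ys → labelsF (xs ++ ys) ≡ labelsF xs ++ labelsF ys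
labelsF-++ [] ys = refl
labelsF-++ (x ∷ xs) ys = trans (cong (labels x ++_) (labelsF-++ xs ys)) (sym (++-assoc (labels x) _ _))

label∈labelsF : ∀ {c ts} → c ∈ ts → label c ∈ labelsF ts
label∈labelsF {node l _} (here refl) = here refl
label∈labelsF {ts = t ∷ _} (there c∈) = ∈-++⁺ʳ (labels t) (label∈labelsF c∈)

mutual
  Grown-labels : ∀ {n v t g} → Grown n v t g → labels g ↭ n ∷ labels t
  Grown-labels {n} (here {l} {ts}) rewrite labelsF-++ ts [ leaf n ] =
    ↭-trans (prep l (↭-sym (∷↭∷ʳ n (labelsF ts)))) (swap l n ↭-refl)
  Grown-labels (there {l = l} G) = ↭-trans (prep l (GrownF-labels G)) (swap l _ ↭-refl)

  GrownF-labels : ∀ {n v ts gs} → GrownF n v ts gs → labelsF gs ↭ n ∷ labelsF ts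
  GrownF-labels (head {cs = cs} G) = ++⁺ʳ (labelsF cs) (Grown-labels G)
  GrownF-labels {n} (tail {c = c} {cs} G) =
    ↭-trans (++⁺ˡ (labels c) (GrownF-labels G)) (shift n (labels c) (labelsF cs))

Grown-label : ∀ {n v t g} → Grown n v t g → label g ≡ label t
Grown-label here = refl
Grown-label (there _) = refl

GrownF-labelMap : ∀ {n v ts gs} → GrownF n v ts gs → map label gs ≡ map label ts
GrownF-labelMap (head G) = cong (_∷ _) (Grown-label G)
GrownF-labelMap (tail G) = cong (_ ∷_) (GrownF-labelMap G)

GrownF-length : ∀ {n v ts gs} → GrownF n v ts gs → length gs ≡ length ts
GrownF-length (head _) = refl
GrownF-length (tail G) = cong suc (GrownF-length G)

childrenAbove-++ : ∀ l xs ys → childrenAbove l (xs ++ ys) ≡ childrenAbove l xs ∧ childrenAbove l ys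
childrenAbove-++ l [] ys = refl
childrenAbove-++ l (x ∷ xs) ys =
  trans (cong ((l <ᵇ label x) ∧_) (childrenAbove-++ l xs ys)) (sym (∧-assoc (l <ᵇ label x) _ _))

increasingForest-++ : ∀ xs ys → increasingForest (xs ++ ys) ≡ increasingForest xs ∧ increasingForest ys
increasingForest-++ [] ys = refl
increasingForest-++ (x ∷ xs) ys =
  trans (cong (increasingTree x ∧_) (increasingForest-++ xs ys)) (sym (∧-assoc (increasingTree x) _ _))

childrenAbove-cong : ∀ l {xs ys} → map label xs ≡ map label ys → childrenAbove l xs ≡ childrenAbove l ys
childrenAbove-cong l {[]} {[]} _ = refl
childrenAbove-cong l {[]} {_ ∷ _} ()
childrenAbove-cong l {_ ∷ _} {[]} ()
childrenAbove-cong l {x ∷ xs} {y ∷ ys} eq =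
  cong₂ (λ k b → (l <ᵇ k) ∧ b) (∷-injectiveˡ eq) (childrenAbove-cong l (∷-injectiveʳ eq))

increasingLabels-cong : ∀ {xs ys} → map label xs ≡ map label ys → increasingLabels xs ≡ increasingLabels ys
increasingLabels-cong {[]} {[]} _ = refl
increasingLabels-cong {_ ∷ []} {_ ∷ []} _ = refl
increasingLabels-cong {x ∷ x′ ∷ xs} {y ∷ y′ ∷ ys} eq = cong₂ _∧_
  (cong₂ _<ᵇ_ (∷-injectiveˡ eq) (∷-injectiveˡ (∷-injectiveʳ eq))) (increasingLabels-cong (∷-injectiveʳ eq))
increasingLabels-cong {[]} {_ ∷ _} ()
increasingLabels-cong {_ ∷ _} {[]} ()
increasingLabels-cong {_ ∷ []} {_ ∷ _ ∷ _} ()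
increasingLabels-cong {_ ∷ _ ∷ _} {_ ∷ []} ()

increasingLabels-∷ʳ⁻ : ∀ ts x → T (increasingLabels (ts ++ [ x ])) → T (increasingLabels ts)
increasingLabels-∷ʳ⁻ [] x _ = _
increasingLabels-∷ʳ⁻ (t ∷ []) x _ = _
increasingLabels-∷ʳ⁻ (t ∷ u ∷ ts) x inc = let t<u , rest = to T-∧ inc in
  from T-∧ (t<u , increasingLabels-∷ʳ⁻ (u ∷ ts) x rest)

increasingLabels-∷ʳ⁺ : ∀ ts x → T (increasingLabels ts) → (∀ {c} → c ∈ ts → label c < label x) →
                       T (increasingLabels (ts ++ [ x ]))
increasingLabels-∷ʳ⁺ [] x _ _ = _
increasingLabels-∷ʳ⁺ (t ∷ []) x _ below = from T-∧ (<⇒<ᵇ (below (here refl)) , _)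
increasingLabels-∷ʳ⁺ (t ∷ u ∷ ts) x inc below = let t<u , rest = to T-∧ inc in
  from T-∧ (t<u , increasingLabels-∷ʳ⁺ (u ∷ ts) x rest (λ c∈ → below (there c∈)))

increasingTree-node : ∀ l ts → T (increasingTree (node l ts)) ⇔
  (T (childrenAbove l ts) × T (increasingLabels ts) × T (increasingForest ts))
increasingTree-node l ts = mk⇔
  (λ inc → let above , rest = to T-∧ inc in above , to T-∧ rest)
  (λ (above , incL , incF) → from T-∧ (above , from T-∧ (incL , incF)))

mutual
  Grown-increasing⁻ : ∀ {n v t g} → Grown n v t g → T (increasingTree g) → T (increasingTree t)
  Grown-increasing⁻ {n} (here {l} {ts}) inc with above , incL , incF ← to (increasingTree-node l (ts ++ [ leaf n ])) inc =
    from (increasingTree-node l ts)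
      ( proj₁ (to T-∧ (subst T (childrenAbove-++ l ts [ leaf n ]) above))
      , increasingLabels-∷ʳ⁻ ts (leaf n) incL
      , proj₁ (to T-∧ (subst T (increasingForest-++ ts [ leaf n ]) incF)))
  Grown-increasing⁻ (there {l = l} {ts} {gs} G) inc with above , incL , incF ← to (increasingTree-node l gs) inc =
    from (increasingTree-node l ts)
      ( subst T (childrenAbove-cong l (GrownF-labelMap G)) above
      , subst T (increasingLabels-cong (GrownF-labelMap G)) incL
      , GrownF-increasing⁻ G incF)

  GrownF-increasing⁻ : ∀ {n v ts gs} → GrownF n v ts gs → T (increasingForest gs) → T (increasingForest ts)
  GrownF-increasing⁻ (head G) inc with incG , incCs ← to T-∧ inc = from T-∧ (Grown-increasing⁻ G incG , incCs)
  GrownF-increasing⁻ (tail G) inc with incC , incGs ← to T-∧ inc = from T-∧ (incC , GrownF-increasing⁻ G incGs)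

mutual
  Grown-increasing⁺ : ∀ {n v t g} → Grown n v t g → T (increasingTree t) →
                      (∀ {x} → x ∈ labels t → x < n) → T (increasingTree g)
  Grown-increasing⁺ {n} (here {l} {ts}) inc below with above , incL , incF ← to (increasingTree-node l ts) inc =
    from (increasingTree-node l (ts ++ [ leaf n ]))
      ( subst T (sym (childrenAbove-++ l ts [ leaf n ])) (from T-∧ (above , from T-∧ (<⇒<ᵇ (below (here refl)) , _)))
      , increasingLabels-∷ʳ⁺ ts (leaf n) incL (λ c∈ → below (there (label∈labelsF c∈)))
      , subst T (sym (increasingForest-++ ts [ leaf n ])) (from T-∧ (incF , _)))
  Grown-increasing⁺ (there {l = l} {ts} {gs} G) inc below with above , incL , incF ← to (increasingTree-node l ts) inc =
    from (increasingTree-node l gs)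
      ( subst T (sym (childrenAbove-cong l (GrownF-labelMap G))) above
      , subst T (sym (increasingLabels-cong (GrownF-labelMap G))) incL
      , GrownF-increasing⁺ G incF (λ x∈ → below (there x∈)))

  GrownF-increasing⁺ : ∀ {n v ts gs} → GrownF n v ts gs → T (increasingForest ts) →
                       (∀ {x} → x ∈ labelsF ts → x < n) → T (increasingForest gs)
  GrownF-increasing⁺ (head G) inc below with incC , incCs ← to T-∧ inc =
    from T-∧ (Grown-increasing⁺ G incC (λ x∈ → below (∈-++⁺ˡ x∈)) , incCs)
  GrownF-increasing⁺ (tail {c = c} G) inc below with incC , incCs ← to T-∧ inc =
    from T-∧ (incC , GrownF-increasing⁺ G incCs (λ x∈ → below (∈-++⁺ʳ (labels c) x∈)))

∈-grow⁻ : ∀ {n g} t → g ∈ grow n t → ∃ λ v → Grown n v t g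
∈-grow⁻ t g∈ with (v , g) , v,g∈ , refl ← ∈-map⁻ proj₂ g∈ = v , ∈-sites⁻ t v,g∈

∈-grow⁺ : ∀ {n v t g} → Grown n v t g → g ∈ grow n t
∈-grow⁺ G = ∈-map⁺ proj₂ (∈-sites⁺ G)

trees-sound : ∀ m {t} → t ∈ trees m → (labels t ↭ upTo (suc m)) × T (increasingTree t)
trees-sound zero (here refl) = ↭-refl , _
trees-sound (suc m) t∈
  with t₀ , t₀∈ , t∈grow ← find (∈-concatMap⁻ (grow (suc m)) {xs = trees m} t∈)
  with v , G ← ∈-grow⁻ t₀ t∈grow
  with perm , inc ← trees-sound m t₀∈ =
    ↭-trans (Grown-labels G) (↭-trans (prep (suc m) perm) (↭-sym (upTo-suc-↭ (suc m))))
  , Grown-increasing⁺ G inc (λ x∈ → ∈-upTo⁻ (∈-resp-↭ perm x∈))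

-- Removing the maximal leaf

mutual
  removeT : ℕ → Tree → Tree
  removeT n (node l ts) = node l (removeF n ts)

  removeF : ℕ → List Tree → List Tree
  removeF n [] = []
  removeF n (c ∷ cs) = if n ≡ᵇ label c then removeF n cs else removeT n c ∷ removeF n cs

label∈labels : ∀ t → label t ∈ labels t
label∈labels (node l ts) = here refl

removeF-hit : ∀ {n} c cs → n ≡ label c → removeF n (c ∷ cs) ≡ removeF n cs
removeF-hit c cs n≡c rewrite ≡ᵇ-true n≡c = refl

removeF-miss : ∀ {n} c cs → n ≢ label c → removeF n (c ∷ cs) ≡ removeT n c ∷ removeF n cs
removeF-miss c cs n≢c rewrite ≡ᵇ-false n≢c = refl

removeF-++ : ∀ n xs ys → removeF n (xs ++ ys) ≡ removeF n xs ++ removeF n ys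
removeF-++ n [] ys = refl
removeF-++ n (x ∷ xs) ys with n ≡ᵇ label x
... | true = removeF-++ n xs ys
... | false = cong (removeT n x ∷_) (removeF-++ n xs ys)

mutual
  removeT-∉ : ∀ {n} t → n ∉ labels t → removeT n t ≡ t
  removeT-∉ (node l ts) n∉ = cong (node l) (removeF-∉ ts (λ n∈ → n∉ (there n∈)))

  removeF-∉ : ∀ {n} ts → n ∉ labelsF ts → removeF n ts ≡ ts
  removeF-∉ [] _ = refl
  removeF-∉ (c ∷ cs) n∉ =
    trans (removeF-skip c cs (λ n∈ → n∉ (∈-++⁺ˡ n∈)))
          (cong (c ∷_) (removeF-∉ cs (λ n∈ → n∉ (∈-++⁺ʳ (labels c) n∈))))

  removeF-skip : ∀ {n} c cs → n ∉ labels c → removeF n (c ∷ cs) ≡ c ∷ removeF n cs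
  removeF-skip {n} c cs n∉ rewrite ≡ᵇ-false {n} {label c} (λ { refl → n∉ (label∈labels c) }) =
    cong (_∷ removeF n cs) (removeT-∉ c n∉)

mutual
  removeT-Grown : ∀ {n v t g} → n ∉ labels t → Grown n v t g → removeT n g ≡ t
  removeT-Grown {n} n∉ (here {l} {ts}) = cong (node l) (begin
    removeF n (ts ++ [ leaf n ])          ≡⟨ removeF-++ n ts [ leaf n ] ⟩
    removeF n ts ++ removeF n [ leaf n ]  ≡⟨ cong₂ _++_ (removeF-∉ ts (λ n∈ → n∉ (there n∈))) (removeF-hit (leaf n) [] refl) ⟩
    ts ++ []                              ≡⟨ ++-identityʳ ts ⟩
    ts                                    ∎)
    where open ≡-Reasoning
  removeT-Grown n∉ (there {l = l} G) = cong (node l) (removeF-Grown (λ n∈ → n∉ (there n∈)) G)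

  removeF-Grown : ∀ {n v ts gs} → n ∉ labelsF ts → GrownF n v ts gs → removeF n gs ≡ ts
  removeF-Grown {n} n∉ (head {c = c} {g} {cs} G) rewrite ≡ᵇ-false {n} {label g}
    (λ n≡g → n∉ (∈-++⁺ˡ (subst (_∈ labels c) (sym (trans n≡g (Grown-label G))) (label∈labels c)))) =
    cong₂ _∷_ (removeT-Grown (λ n∈ → n∉ (∈-++⁺ˡ n∈)) G) (removeF-∉ cs (λ n∈ → n∉ (∈-++⁺ʳ (labels c) n∈)))
  removeF-Grown n∉ (tail {c = c} {gs = gs} G) =
    trans (removeF-skip c gs (λ n∈ → n∉ (∈-++⁺ˡ n∈)))
          (cong (c ∷_) (removeF-Grown (λ n∈ → n∉ (∈-++⁺ʳ (labels c) n∈)) G))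

childrenAbove-bounded : ∀ {l} ts → T (childrenAbove l ts) → (∀ {x} → x ∈ labelsF ts → x ≤ l) → ts ≡ []
childrenAbove-bounded [] _ _ = refl
childrenAbove-bounded {l} (d ∷ ds) above bounded =
  ⊥-elim (<⇒≱ (<ᵇ⇒< l (label d) (proj₁ (to T-∧ above))) (bounded (label∈labelsF {d} {d ∷ ds} (here refl))))

increasingLabels-bounded : ∀ c cs → T (increasingLabels (c ∷ cs)) → (∀ {x} → x ∈ labelsF cs → x ≤ label c) → cs ≡ []
increasingLabels-bounded c [] _ _ = refl
increasingLabels-bounded c (u ∷ us) inc bounded =
  ⊥-elim (<⇒≱ (<ᵇ⇒< (label c) (label u) (proj₁ (to T-∧ inc))) (bounded (label∈labelsF {u} {u ∷ us} (here refl))))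

increasingLabels-tail : ∀ c cs → T (increasingLabels (c ∷ cs)) → T (increasingLabels cs)
increasingLabels-tail c [] _ = _
increasingLabels-tail c (u ∷ us) inc = proj₂ (to T-∧ inc)

+≡1 : ∀ a b → a + b ≡ 1 → (a ≡ 1 × b ≡ 0) ⊎ (a ≡ 0 × b ≡ 1)
+≡1 zero b eq = inj₂ (refl , eq)
+≡1 (suc zero) zero _ = inj₁ (refl , refl)

mutual
  removeT-grown : ∀ {n} t → n ≢ label t → T (increasingTree t) → countℕ n (labels t) ≡ 1 →
                  (∀ {x} → x ∈ labels t → x ≤ n) → ∃ λ v → Grown n v (removeT n t) t
  removeT-grown {n} (node l ts) n≢l inc once bounded
    with _ , incL , incF ← to (increasingTree-node l ts) inc
    with removeF-grown ts incL incF (trans (sym (countℕ-miss (labelsF ts) n≢l)) once) (λ x∈ → bounded (there x∈))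
  ... | inj₁ ts≡ = _ , subst (Grown n (degreeVar (even? (length (removeF n ts)))) (node l (removeF n ts)) ∘ node l) (sym ts≡) here
  ... | inj₂ (v , G) = swapXY v , there G

  removeF-grown : ∀ {n} ts → T (increasingLabels ts) → T (increasingForest ts) → countℕ n (labelsF ts) ≡ 1 →
                  (∀ {x} → x ∈ labelsF ts → x ≤ n) →
                  ts ≡ removeF n ts ++ [ leaf n ] ⊎ ∃ λ v → GrownF n v (removeF n ts) ts
  removeF-grown {n} (node lc cs′ ∷ cs) incL incF once bounded with n ≟ lc
  ... | yes refl
    with refl ← childrenAbove-bounded cs′ (proj₁ (to (increasingTree-node n cs′) (proj₁ (to T-∧ incF))))
                  (λ x∈ → bounded (∈-++⁺ˡ (there x∈)))
    with refl ← increasingLabels-bounded (leaf n) cs incL (λ x∈ → bounded (∈-++⁺ʳ [ n ] x∈))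
    = inj₁ (cong (_++ [ leaf n ]) (sym (removeF-hit (leaf n) [] refl)))
  ... | no n≢lc with +≡1 (countℕ n (labels (node lc cs′))) _ (trans (sym (countℕ-++ n (labels (node lc cs′)) _)) once)
  ... | inj₁ (onceˡ , noneʳ)
    with v , G ← removeT-grown (node lc cs′) n≢lc (proj₁ (to T-∧ incF)) onceˡ (λ x∈ → bounded (∈-++⁺ˡ x∈))
    = inj₂ (v , subst (λ xs → GrownF n v xs (node lc cs′ ∷ cs)) (sym removed) (head G))
    where
    removed : removeF n (node lc cs′ ∷ cs) ≡ removeT n (node lc cs′) ∷ cs
    removed = trans (removeF-miss (node lc cs′) cs n≢lc)
                    (cong (_ ∷_) (removeF-∉ cs (countℕ≡0⇒∉ noneʳ)))
  ... | inj₂ (noneˡ , onceʳ)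
    with removeF-grown cs (increasingLabels-tail (node lc cs′) cs incL) (proj₂ (to T-∧ incF)) onceʳ
           (λ x∈ → bounded (∈-++⁺ʳ (labels (node lc cs′)) x∈))
  ... | inj₁ cs≡ = inj₁ (trans (cong (_ ∷_) cs≡)
                               (cong (_++ [ leaf n ]) (sym (removeF-skip (node lc cs′) cs (countℕ≡0⇒∉ noneˡ)))))
  ... | inj₂ (v , G) = inj₂ (v , subst (λ xs → GrownF n v xs (node lc cs′ ∷ cs))
                                       (sym (removeF-skip (node lc cs′) cs (countℕ≡0⇒∉ noneˡ))) (tail G))

labelsF≡[] : ∀ ts → labelsF ts ≡ [] → ts ≡ []
labelsF≡[] [] _ = refl
labelsF≡[] (node _ _ ∷ _) ()

trees-complete : ∀ m {t} → labels t ↭ upTo (suc m) → T (increasingTree t) → t ∈ trees m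
trees-complete zero {node l ts} perm _ with ↭-singleton-inv perm
... | eq with refl ← ∷-injectiveˡ eq | refl ← labelsF≡[] ts (∷-injectiveʳ eq) = here refl
trees-complete (suc m) {node l ts} perm inc =
  ∈-concatMap⁺ (grow n) (lose (trees-complete m perm₀ (Grown-increasing⁻ G inc)) (∈-grow⁺ G))
  where
  n : ℕ
  n = suc m
  bounded : ∀ {x} → x ∈ labels (node l ts) → x ≤ n
  bounded x∈ = s≤s⁻¹ (∈-upTo⁻ (∈-resp-↭ perm x∈))
  n≢l : n ≢ l
  n≢l refl with refl ← childrenAbove-bounded ts (proj₁ (to (increasingTree-node l ts) inc)) (λ x∈ → bounded (there x∈))
    = case ↭-length perm of λ ()
  grown : ∃ λ v → Grown n v (removeT n (node l ts)) (node l ts)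
  grown = removeT-grown (node l ts) n≢l inc (trans (countℕ-↭ n perm) (countℕ-upTo-< (suc n) ≤-refl)) bounded
  G : Grown n (proj₁ grown) (removeT n (node l ts)) (node l ts)
  G = proj₂ grown
  perm₀ : labels (removeT n (node l ts)) ↭ upTo n
  perm₀ = drop-∷ (↭-trans (↭-sym (Grown-labels G)) (↭-trans perm (upTo-suc-↭ n)))

-- Enumerating 𝒯_m

growF : ℕ → List Tree → List (List Tree)
growF n ts = map proj₂ (sitesF n ts)

map-proj₂-map : ∀ {A B C D : Set} (f : A → C) (g : B → D) (ps : List (A × B)) →
                map proj₂ (map (Prod.map f g) ps) ≡ map g (map proj₂ ps)
map-proj₂-map f g ps = trans (sym (map-∘ ps)) (map-∘ ps)

grow-node : ∀ n l ts → grow n (node l ts) ≡ node l (ts ++ [ leaf n ]) ∷ map (node l) (growF n ts)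
grow-node n l ts = cong (node l (ts ++ [ leaf n ]) ∷_) (map-proj₂-map swapXY (node l) (sitesF n ts))

growF-∷ : ∀ n c cs → growF n (c ∷ cs) ≡ map (_∷ cs) (grow n c) ++ map (c ∷_) (growF n cs)
growF-∷ n c cs = begin
  map proj₂ (map (Prod.map₂ (_∷ cs)) (sites n c) ++ map (Prod.map₂ (c ∷_)) (sitesF n cs))
    ≡⟨ map-++ proj₂ (map (Prod.map₂ (_∷ cs)) (sites n c)) _ ⟩
  map proj₂ (map (Prod.map₂ (_∷ cs)) (sites n c)) ++ map proj₂ (map (Prod.map₂ (c ∷_)) (sitesF n cs))
    ≡⟨ cong₂ _++_ (map-proj₂-map id (_∷ cs) (sites n c)) (map-proj₂-map id (c ∷_) (sitesF n cs)) ⟩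
  map (_∷ cs) (grow n c) ++ map (c ∷_) (growF n cs)
    ∎
  where open ≡-Reasoning

∈-growF⁻ : ∀ {n gs} ts → gs ∈ growF n ts → ∃ λ v → GrownF n v ts gs
∈-growF⁻ ts gs∈ with (v , gs) , v,gs∈ , refl ← ∈-map⁻ proj₂ gs∈ = v , ∈-sitesF⁻ ts v,gs∈

node-injective : ∀ {l xs ys} → node l xs ≡ node l ys → xs ≡ ys
node-injective refl = refl

mutual
  grow-unique : ∀ n t → Unique (grow n t)
  grow-unique n (node l ts) = subst Unique (sym (grow-node n l ts))
    (All.tabulate new≢ AllPairs.∷ UP.map⁺ node-injective (growF-unique n ts))
    where
    new≢ : ∀ {x} → x ∈ map (node l) (growF n ts) → node l (ts ++ [ leaf n ]) ≢ x
    new≢ x∈ eq with gs , gs∈ , refl ← ∈-map⁻ (node l) x∈ with _ , G ← ∈-growF⁻ ts gs∈ =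
      m+1+n≢m (length ts) (trans (sym (length-++ ts)) (trans (cong length (node-injective eq)) (GrownF-length G)))

  growF-unique : ∀ n ts → Unique (growF n ts)
  growF-unique n [] = AllPairs.[]
  growF-unique n (c ∷ cs) = subst Unique (sym (growF-∷ n c cs))
    (UP.++⁺ (UP.map⁺ ∷-injectiveˡ (grow-unique n c)) (UP.map⁺ ∷-injectiveʳ (growF-unique n cs)) disjoint)
    where
    disjoint : ∀ {gs} → ¬ (gs ∈ map (_∷ cs) (grow n c) × gs ∈ map (c ∷_) (growF n cs))
    disjoint (gs∈ˡ , gs∈ʳ) with g , g∈ , refl ← ∈-map⁻ (_∷ cs) gs∈ˡ | _ , _ , eq ← ∈-map⁻ (c ∷_) gs∈ʳ
      with _ , G ← ∈-grow⁻ c g∈ =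
      1+n≢n (trans (sym (↭-length (Grown-labels G))) (cong (length ∘ labels) (∷-injectiveˡ eq)))

Unique-concatMap : ∀ {A B : Set} (f : A → List B) (r : B → A) {xs} → Unique xs →
                   (∀ {x} → x ∈ xs → Unique (f x)) → (∀ {x y} → x ∈ xs → y ∈ f x → r y ≡ x) →
                   Unique (concatMap f xs)
Unique-concatMap f r {[]} _ _ _ = AllPairs.[]
Unique-concatMap f r {x ∷ xs} (x∉xs AllPairs.∷ uxs) uf retract =
  UP.++⁺ (uf (here refl)) (Unique-concatMap f r uxs (λ x∈ → uf (there x∈)) (λ x∈ → retract (there x∈))) disjoint
  where
  disjoint : ∀ {y} → ¬ (y ∈ f x × y ∈ concatMap f xs)
  disjoint (y∈fx , y∈rest) with z , z∈ , y∈fz ← find (∈-concatMap⁻ f {xs = xs} y∈rest) =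
    All.lookup x∉xs z∈ (trans (sym (retract (here refl) y∈fx)) (retract (there z∈) y∈fz))

trees-unique : ∀ m → Unique (trees m)
trees-unique zero = All.[] AllPairs.∷ AllPairs.[]
trees-unique (suc m) = Unique-concatMap (grow (suc m)) (removeT (suc m)) (trees-unique m)
  (λ {t} _ → grow-unique (suc m) t)
  (λ t∈ g∈ → removeT-Grown (new∉ t∈) (proj₂ (∈-grow⁻ _ g∈)))
  where
  new∉ : ∀ {t} → t ∈ trees m → suc m ∉ labels t
  new∉ t∈ m+1∈ = <-irrefl refl (∈-upTo⁻ (∈-resp-↭ (proj₁ (trees-sound m t∈)) m+1∈))

-- Exponents under growth

δ : Var → Var → ℕ
δ X X = 1
δ Y Y = 1
δ Z Z = 1
δ _ _ = 0

δ-swapXY : ∀ v w → δ (swapXY v) w ≡ δ v (swapXY w)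
δ-swapXY X X = refl
δ-swapXY X Y = refl
δ-swapXY X Z = refl
δ-swapXY Y X = refl
δ-swapXY Y Y = refl
δ-swapXY Y Z = refl
δ-swapXY Z X = refl
δ-swapXY Z Y = refl
δ-swapXY Z Z = refl

exponent : Var → Tree → ℕ
exponent X = ee
exponent Y = oe
exponent Z = odd

exponentF : Var → List Tree → ℕ
exponentF v ts = sum (map (exponent v) ts)

exponentF-++ : ∀ v xs ys → exponentF v (xs ++ ys) ≡ exponentF v xs + exponentF v ys
exponentF-++ v xs ys = trans (cong sum (map-++ (exponent v) xs ys)) (sum-++ (map (exponent v) xs) _)

evenDegOnEvenF-sum : ∀ ev ts → evenDegOnEvenF ev ts ≡ sum (map (evenDegOnEven ev) ts)
evenDegOnEvenF-sum ev [] = refl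
evenDegOnEvenF-sum ev (t ∷ ts) = cong (evenDegOnEven ev t +_) (evenDegOnEvenF-sum ev ts)

oddDegF-sum : ∀ ts → oddDegF ts ≡ sum (map oddDeg ts)
oddDegF-sum [] = refl
oddDegF-sum (t ∷ ts) = cong (oddDeg t +_) (oddDegF-sum ts)

-- The children of a node lie on the opposite level parity, which exchanges the roles of x and y.
exponent-node : ∀ v l ts → exponent v (node l ts) ≡ δ (degreeVar (even? (length ts))) v + exponentF (swapXY v) ts
exponent-node X l ts = cong₂ _+_ (root (even? (length ts))) (evenDegOnEvenF-sum false ts)
  where
  root : ∀ e → b2n e ≡ δ (degreeVar e) X
  root true = refl
  root false = refl
exponent-node Y l ts = cong₂ _+_ (root (even? (length ts))) (evenDegOnEvenF-sum true ts)
  where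
  root : ∀ e → 0 ≡ δ (degreeVar e) Y
  root true = refl
  root false = refl
exponent-node Z l ts = cong₂ _+_ (root (even? (length ts))) (oddDegF-sum ts)
  where
  root : ∀ e → b2n (not e) ≡ δ (degreeVar e) Z
  root true = refl
  root false = refl

exponent-leaf : ∀ v n → exponent v (leaf n) ≡ δ X v
exponent-leaf X n = refl
exponent-leaf Y n = refl
exponent-leaf Z n = refl

even?-length-∷ʳ : ∀ (ts : List Tree) x → even? (length (ts ++ [ x ])) ≡ not (even? (length ts))
even?-length-∷ʳ ts x = cong even? (trans (length-++ ts) (+-comm (length ts) 1))

-- The receiving node changes degree parity and the new leaf has even degree on the opposite level.
degreeVar-flip : ∀ e w → δ (degreeVar (not e)) w + δ X (swapXY w) + 2 * δ (degreeVar e) w ≡ suc (δ (degreeVar e) w)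
degreeVar-flip true X = refl
degreeVar-flip true Y = refl
degreeVar-flip true Z = refl
degreeVar-flip false X = refl
degreeVar-flip false Y = refl
degreeVar-flip false Z = refl

mutual
  exponent-Grown : ∀ {n v t g} → Grown n v t g → ∀ w → exponent w g + 2 * δ v w ≡ suc (exponent w t)
  exponent-Grown {n} (here {l} {ts}) w = begin
    exponent w (node l (ts ++ [ leaf n ])) + 2 * δ k w
      ≡⟨ cong (_+ 2 * δ k w) (exponent-node w l (ts ++ [ leaf n ])) ⟩
    δ (degreeVar (even? (length (ts ++ [ leaf n ])))) w + exponentF (swapXY w) (ts ++ [ leaf n ]) + 2 * δ k w
      ≡⟨ cong₂ (λ e F → δ (degreeVar e) w + F + 2 * δ k w) (even?-length-∷ʳ ts (leaf n))
               (trans (exponentF-++ (swapXY w) ts [ leaf n ]) (cong (F +_) (+-identityʳ _))) ⟩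
    δ (degreeVar (not e)) w + (F + exponent (swapXY w) (leaf n)) + 2 * δ k w
      ≡⟨ cong (λ x → δ (degreeVar (not e)) w + (F + x) + 2 * δ k w) (exponent-leaf (swapXY w) n) ⟩
    δ (degreeVar (not e)) w + (F + δ X (swapXY w)) + 2 * δ k w
      ≡⟨ move-F (δ (degreeVar (not e)) w) F (δ X (swapXY w)) (2 * δ k w) ⟩
    δ (degreeVar (not e)) w + δ X (swapXY w) + 2 * δ k w + F
      ≡⟨ cong (_+ F) (degreeVar-flip e w) ⟩
    suc (δ k w + F)
      ≡⟨ cong suc (sym (exponent-node w l ts)) ⟩
    suc (exponent w (node l ts))
      ∎
    where
    open ≡-Reasoning
    e : Bool
    e = even? (length ts)
    k : Var
    k = degreeVar e
    F : ℕ
    F = exponentF (swapXY w) ts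
    move-F : ∀ a F b c → a + (F + b) + c ≡ a + b + c + F
    move-F = solve-∀
  exponent-Grown (there {v} {l} {ts} {gs} G) w = begin
    exponent w (node l gs) + 2 * δ (swapXY v) w
      ≡⟨ cong₂ _+_ (exponent-node w l gs) (cong (2 *_) (δ-swapXY v w)) ⟩
    δ (degreeVar (even? (length gs))) w + exponentF (swapXY w) gs + 2 * δ v (swapXY w)
      ≡⟨ +-assoc (δ (degreeVar (even? (length gs))) w) _ _ ⟩
    δ (degreeVar (even? (length gs))) w + (exponentF (swapXY w) gs + 2 * δ v (swapXY w))
      ≡⟨ cong₂ (λ len F → δ (degreeVar (even? len)) w + F) (GrownF-length G) (exponentF-Grown G (swapXY w)) ⟩
    δ (degreeVar (even? (length ts))) w + suc (exponentF (swapXY w) ts)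
      ≡⟨ +-suc _ _ ⟩
    suc (δ (degreeVar (even? (length ts))) w + exponentF (swapXY w) ts)
      ≡⟨ cong suc (sym (exponent-node w l ts)) ⟩
    suc (exponent w (node l ts))
      ∎
    where open ≡-Reasoning

  exponentF-Grown : ∀ {n v ts gs} → GrownF n v ts gs → ∀ w → exponentF w gs + 2 * δ v w ≡ suc (exponentF w ts)
  exponentF-Grown {v = v} (head {c = c} {g} {cs} G) w = begin
    exponent w g + exponentF w cs + 2 * δ v w   ≡⟨ swap-last (exponent w g) _ _ ⟩
    exponent w g + 2 * δ v w + exponentF w cs   ≡⟨ cong (_+ exponentF w cs) (exponent-Grown G w) ⟩
    suc (exponent w c + exponentF w cs)         ∎
    where
    open ≡-Reasoning
    swap-last : ∀ a b c → a + b + c ≡ a + c + b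
    swap-last = solve-∀
  exponentF-Grown {v = v} (tail {c = c} {cs} {gs} G) w = begin
    exponent w c + exponentF w gs + 2 * δ v w   ≡⟨ +-assoc (exponent w c) _ _ ⟩
    exponent w c + (exponentF w gs + 2 * δ v w) ≡⟨ cong (exponent w c +_) (exponentF-Grown G w) ⟩
    exponent w c + suc (exponentF w cs)         ≡⟨ +-suc _ _ ⟩
    suc (exponent w c + exponentF w cs)         ∎
    where open ≡-Reasoning

∂exponents : Var → ℕ × ℕ × ℕ → ℕ × ℕ × ℕ
∂exponents X (a , b , c) = (a ∸ 1 , suc b , suc c)
∂exponents Y (a , b , c) = (suc a , b ∸ 1 , suc c)
∂exponents Z (a , b , c) = (suc a , suc b , c ∸ 1)

m+0≡n⇒m≡n : ∀ {m n} → m + 0 ≡ n → m ≡ n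
m+0≡n⇒m≡n {m} eq = trans (sym (+-identityʳ m)) eq

m+2≡1+n⇒m≡n∸1 : ∀ {m n} → m + 2 ≡ suc n → m ≡ n ∸ 1
m+2≡1+n⇒m≡n∸1 {m} eq = trans (sym (m+n∸n≡m m 1)) (cong (_∸ 1) (suc-injective (trans (sym (+-suc m 1)) eq)))

balance⇒∂exponents : ∀ v {a b c a′ b′ c′} →
  a′ + 2 * δ v X ≡ suc a → b′ + 2 * δ v Y ≡ suc b → c′ + 2 * δ v Z ≡ suc c →
  (a′ , b′ , c′) ≡ ∂exponents v (a , b , c)
balance⇒∂exponents X ea eb ec = cong₂ _,_ (m+2≡1+n⇒m≡n∸1 ea) (cong₂ _,_ (m+0≡n⇒m≡n eb) (m+0≡n⇒m≡n ec))
balance⇒∂exponents Y ea eb ec = cong₂ _,_ (m+0≡n⇒m≡n ea) (cong₂ _,_ (m+2≡1+n⇒m≡n∸1 eb) (m+0≡n⇒m≡n ec))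
balance⇒∂exponents Z ea eb ec = cong₂ _,_ (m+0≡n⇒m≡n ea) (cong₂ _,_ (m+0≡n⇒m≡n eb) (m+2≡1+n⇒m≡n∸1 ec))

multiplicity : ∀ {A : Set} → Var → List (Var × A) → ℕ
multiplicity w ps = sum (map (λ p → δ (proj₁ p) w) ps)

multiplicity-map : ∀ {A B : Set} (h : A → B) (f : Var → Var) {w w′} → (∀ v → δ (f v) w ≡ δ v w′) →
                   ∀ ps → multiplicity w (map (Prod.map f h) ps) ≡ multiplicity w′ ps
multiplicity-map h f eq ps = cong sum (trans (sym (map-∘ ps)) (map-cong (λ p → eq (proj₁ p)) ps))

multiplicity-++ : ∀ {A : Set} w (ps qs : List (Var × A)) → multiplicity w (ps ++ qs) ≡ multiplicity w ps + multiplicity w qs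
multiplicity-++ w ps qs = trans (cong sum (map-++ _ ps qs)) (sum-++ (map (λ p → δ (proj₁ p) w) ps) _)

mutual
  multiplicity-sites : ∀ n t w → multiplicity w (sites n t) ≡ exponent w t
  multiplicity-sites n (node l ts) w = begin
    δ k w + multiplicity w (map (Prod.map swapXY (node l)) (sitesF n ts))
      ≡⟨ cong (δ k w +_) (multiplicity-map (node l) swapXY (λ v → δ-swapXY v w) (sitesF n ts)) ⟩
    δ k w + multiplicity (swapXY w) (sitesF n ts)
      ≡⟨ cong (δ k w +_) (multiplicity-sitesF n ts (swapXY w)) ⟩
    δ k w + exponentF (swapXY w) ts
      ≡⟨ sym (exponent-node w l ts) ⟩
    exponent w (node l ts)
      ∎
    where
    open ≡-Reasoning
    k : Var
    k = degreeVar (even? (length ts))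

  multiplicity-sitesF : ∀ n ts w → multiplicity w (sitesF n ts) ≡ exponentF w ts
  multiplicity-sitesF n [] w = refl
  multiplicity-sitesF n (c ∷ cs) w = begin
    multiplicity w (map (Prod.map₂ (_∷ cs)) (sites n c) ++ map (Prod.map₂ (c ∷_)) (sitesF n cs))
      ≡⟨ multiplicity-++ w (map (Prod.map₂ (_∷ cs)) (sites n c)) _ ⟩
    multiplicity w (map (Prod.map₂ (_∷ cs)) (sites n c)) + multiplicity w (map (Prod.map₂ (c ∷_)) (sitesF n cs))
      ≡⟨ cong₂ _+_ (multiplicity-map (_∷ cs) id (λ _ → refl) (sites n c)) (multiplicity-map (c ∷_) id (λ _ → refl) (sitesF n cs)) ⟩
    multiplicity w (sites n c) + multiplicity w (sitesF n cs)
      ≡⟨ cong₂ _+_ (multiplicity-sites n c w) (multiplicity-sitesF n cs w) ⟩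
    exponent w c + exponentF w cs
      ∎
    where open ≡-Reasoning

open import Data.Integer using (ℤ; +_) renaming (_+_ to _+ℤ_; _*_ to _*ℤ_)
import Data.Integer.Properties as ℤ
open import Data.Integer.Tactic.RingSolver renaming (solve-∀ to ℤ-solve-∀)

monomial : Tree → Monomial
monomial t = (+ 1 , ee t , oe t , odd t)

monomial-Grown : ∀ {n v t g} → Grown n v t g → monomial g ≡ (+ 1 , ∂exponents v (ee t , oe t , odd t))
monomial-Grown {v = v} G =
  cong (+ 1 ,_) (balance⇒∂exponents v (exponent-Grown G X) (exponent-Grown G Y) (exponent-Grown G Z))

-- Coefficients of D p

Coeffs : Set
Coeffs = ℕ → ℕ → ℕ → ℤ

_≗₃_ : Coeffs → Coeffs → Set
f ≗₃ g = ∀ a b c → f a b c ≡ g a b c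

monoCoeff : Monomial → Coeffs
monoCoeff (k , a′ , b′ , c′) a b c = if (a′ ≡ᵇ a) ∧ (b′ ≡ᵇ b) ∧ (c′ ≡ᵇ c) then k else + 0

coeff-++ : ∀ p q → coeff (p ++ q) ≗₃ λ a b c → coeff p a b c +ℤ coeff q a b c
coeff-++ [] q a b c = sym (ℤ.+-identityˡ _)
coeff-++ (μ ∷ p) q a b c = trans (cong (monoCoeff μ a b c +ℤ_) (coeff-++ p q a b c)) (sym (ℤ.+-assoc (monoCoeff μ a b c) _ _))

weight : ℕ → ℕ → ℕ → ℤ
weight k (suc _) (suc _) = + suc k
weight k _ _ = + 0

-- [x^a y^b z^c] D p = (a+1) p_{a+1,b-1,c-1} + (b+1) p_{a-1,b+1,c-1} + (c+1) p_{a-1,b-1,c+1},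
-- where a term is present only if the exponents it lowers are positive.
∂ : Coeffs → Coeffs
∂ f a b c = weight a b c *ℤ f (suc a) (b ∸ 1) (c ∸ 1)
         +ℤ weight b a c *ℤ f (a ∸ 1) (suc b) (c ∸ 1)
         +ℤ weight c a b *ℤ f (a ∸ 1) (b ∸ 1) (suc c)

∂-cong : ∀ {f g} → f ≗₃ g → ∂ f ≗₃ ∂ g
∂-cong f≗g a b c = cong₂ _+ℤ_
  (cong₂ _+ℤ_ (cong (weight a b c *ℤ_) (f≗g _ _ _)) (cong (weight b a c *ℤ_) (f≗g _ _ _)))
  (cong (weight c a b *ℤ_) (f≗g _ _ _))

∂-+ : ∀ f g → ∂ (λ a b c → f a b c +ℤ g a b c) ≗₃ λ a b c → ∂ f a b c +ℤ ∂ g a b c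
∂-+ f g a b c = distrib (weight a b c) (weight b a c) (weight c a b) _ _ _ _ _ _
  where
  distrib : ∀ u v w f₁ f₂ f₃ g₁ g₂ g₃ →
    u *ℤ (f₁ +ℤ g₁) +ℤ v *ℤ (f₂ +ℤ g₂) +ℤ w *ℤ (f₃ +ℤ g₃) ≡
    (u *ℤ f₁ +ℤ v *ℤ f₂ +ℤ w *ℤ f₃) +ℤ (u *ℤ g₁ +ℤ v *ℤ g₂ +ℤ w *ℤ g₃)
  distrib = ℤ-solve-∀

∂-zero : ∂ (λ _ _ _ → + 0) ≗₃ λ _ _ _ → + 0
∂-zero a b c rewrite ℤ.*-zeroʳ (weight a b c) | ℤ.*-zeroʳ (weight b a c) | ℤ.*-zeroʳ (weight c a b) = refl

if-scale : ∀ B k {n m} → (T B → n ≡ m) → (if B then k *ℤ + n else + 0) ≡ + m *ℤ (if B then k else + 0)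
if-scale true k n≡m rewrite n≡m _ = ℤ.*-comm k _
if-scale false k {m = m} _ = sym (ℤ.*-zeroʳ (+ m))

if-*-zero : ∀ B k m → (if B then k *ℤ + 0 else + 0) ≡ + m *ℤ + 0
if-*-zero B k m = trans (lemma B) (sym (ℤ.*-zeroʳ (+ m)))
  where
  lemma : ∀ B → (if B then k *ℤ + 0 else + 0) ≡ + 0
  lemma true = ℤ.*-zeroʳ k
  lemma false = refl

if-false : ∀ {B} k → B ≡ false → (if B then k else + 0) ≡ + 0
if-false k refl = refl

monoCoeff-∂x : ∀ k a′ b′ c′ a b c →
  monoCoeff (k *ℤ + a′ , a′ ∸ 1 , suc b′ , suc c′) a b c
    ≡ weight a b c *ℤ monoCoeff (k , a′ , b′ , c′) (suc a) (b ∸ 1) (c ∸ 1)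
monoCoeff-∂x k a′ b′ c′ a zero c = if-false _ (∧-zeroʳ (a′ ∸ 1 ≡ᵇ a))
monoCoeff-∂x k a′ b′ c′ a (suc b) zero = if-false _ (trans (cong ((a′ ∸ 1 ≡ᵇ a) ∧_) (∧-zeroʳ (b′ ≡ᵇ b))) (∧-zeroʳ _))
monoCoeff-∂x k zero b′ c′ a (suc b) (suc c) = if-*-zero _ k (suc a)
monoCoeff-∂x k (suc a′) b′ c′ a (suc b) (suc c) = if-scale _ k (λ h → cong suc (≡ᵇ⇒≡ a′ a (proj₁ (to T-∧ h))))

monoCoeff-∂y : ∀ k a′ b′ c′ a b c →
  monoCoeff (k *ℤ + b′ , suc a′ , b′ ∸ 1 , suc c′) a b c
    ≡ weight b a c *ℤ monoCoeff (k , a′ , b′ , c′) (a ∸ 1) (suc b) (c ∸ 1)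
monoCoeff-∂y k a′ b′ c′ zero b c = refl
monoCoeff-∂y k a′ b′ c′ (suc a) b zero = if-false _ (trans (cong ((a′ ≡ᵇ a) ∧_) (∧-zeroʳ (b′ ∸ 1 ≡ᵇ b))) (∧-zeroʳ _))
monoCoeff-∂y k a′ zero c′ (suc a) b (suc c) =
  trans (if-*-zero _ k (suc b)) (cong (+ suc b *ℤ_) (sym (if-false k (∧-zeroʳ (a′ ≡ᵇ a)))))
monoCoeff-∂y k a′ (suc b′) c′ (suc a) b (suc c) =
  if-scale _ k (λ h → cong suc (≡ᵇ⇒≡ b′ b (proj₁ (to T-∧ (proj₂ (to (T-∧ {a′ ≡ᵇ a}) h))))))

monoCoeff-∂z : ∀ k a′ b′ c′ a b c →
  monoCoeff (k *ℤ + c′ , suc a′ , suc b′ , c′ ∸ 1) a b c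
    ≡ weight c a b *ℤ monoCoeff (k , a′ , b′ , c′) (a ∸ 1) (b ∸ 1) (suc c)
monoCoeff-∂z k a′ b′ c′ zero b c = refl
monoCoeff-∂z k a′ b′ c′ (suc a) zero c = if-false _ (∧-zeroʳ (a′ ≡ᵇ a))
monoCoeff-∂z k a′ b′ zero (suc a) (suc b) c =
  trans (if-*-zero _ k (suc c)) (cong (+ suc c *ℤ_) (sym (if-false k (trans (cong ((a′ ≡ᵇ a) ∧_) (∧-zeroʳ (b′ ≡ᵇ b))) (∧-zeroʳ _)))))
monoCoeff-∂z k a′ b′ (suc c′) (suc a) (suc b) c =
  if-scale _ k (λ h → cong suc (≡ᵇ⇒≡ c′ c (proj₂ (to (T-∧ {b′ ≡ᵇ b}) (proj₂ (to (T-∧ {a′ ≡ᵇ a}) h))))))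

coeff-Dmono : ∀ μ → coeff (Dmono μ) ≗₃ ∂ (monoCoeff μ)
coeff-Dmono (k , a′ , b′ , c′) a b c
  rewrite monoCoeff-∂x k a′ b′ c′ a b c | monoCoeff-∂y k a′ b′ c′ a b c | monoCoeff-∂z k a′ b′ c′ a b c
        | ℤ.+-identityʳ (weight c a b *ℤ monoCoeff (k , a′ , b′ , c′) (a ∸ 1) (b ∸ 1) (suc c)) =
  sym (ℤ.+-assoc (weight a b c *ℤ monoCoeff (k , a′ , b′ , c′) (suc a) (b ∸ 1) (c ∸ 1)) _ _)

coeff-D : ∀ p → coeff (D p) ≗₃ ∂ (coeff p)
coeff-D [] a b c = sym (∂-zero a b c)
coeff-D (μ ∷ p) a b c = begin
  coeff (Dmono μ ++ D p) a b c                 ≡⟨ coeff-++ (Dmono μ) (D p) a b c ⟩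
  coeff (Dmono μ) a b c +ℤ coeff (D p) a b c   ≡⟨ cong₂ _+ℤ_ (coeff-Dmono μ a b c) (coeff-D p a b c) ⟩
  ∂ (monoCoeff μ) a b c +ℤ ∂ (coeff p) a b c   ≡⟨ sym (∂-+ (monoCoeff μ) (coeff p) a b c) ⟩
  ∂ (coeff (μ ∷ p)) a b c                      ∎
  where open ≡-Reasoning

coeff-concatMap-cong : ∀ {A : Set} {f g : A → Poly} → (∀ x → coeff (f x) ≗₃ coeff (g x)) →
                       ∀ xs → coeff (concatMap f xs) ≗₃ coeff (concatMap g xs)
coeff-concatMap-cong f≗g [] a b c = refl
coeff-concatMap-cong {f = f} {g} f≗g (x ∷ xs) a b c = begin
  coeff (f x ++ concatMap f xs) a b c                  ≡⟨ coeff-++ (f x) _ a b c ⟩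
  coeff (f x) a b c +ℤ coeff (concatMap f xs) a b c    ≡⟨ cong₂ _+ℤ_ (f≗g x a b c) (coeff-concatMap-cong f≗g xs a b c) ⟩
  coeff (g x) a b c +ℤ coeff (concatMap g xs) a b c    ≡⟨ sym (coeff-++ (g x) _ a b c) ⟩
  coeff (g x ++ concatMap g xs) a b c                  ∎
  where open ≡-Reasoning

monoCoeff-zero : ∀ e → monoCoeff (+ 0 , e) ≗₃ λ _ _ _ → + 0
monoCoeff-zero (a′ , b′ , c′) a b c with (a′ ≡ᵇ a) ∧ (b′ ≡ᵇ b) ∧ (c′ ≡ᵇ c)
... | true = refl
... | false = refl

monoCoeff-suc : ∀ k e → monoCoeff (+ suc k , e) ≗₃ λ a b c → monoCoeff (+ 1 , e) a b c +ℤ monoCoeff (+ k , e) a b c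
monoCoeff-suc k (a′ , b′ , c′) a b c with (a′ ≡ᵇ a) ∧ (b′ ≡ᵇ b) ∧ (c′ ≡ᵇ c)
... | true = refl
... | false = refl

derivativeTerms : (Var → ℕ) → ℕ × ℕ × ℕ → Poly
derivativeTerms k e = (+ k X , ∂exponents X e) ∷ (+ k Y , ∂exponents Y e) ∷ (+ k Z , ∂exponents Z e) ∷ []

coeff-unitShifts : ∀ {A : Set} e (ps : List (Var × A)) →
  coeff (map (λ p → + 1 , ∂exponents (proj₁ p) e) ps) ≗₃ coeff (derivativeTerms (λ v → multiplicity v ps) e)
coeff-unitShifts e [] a b c
  rewrite monoCoeff-zero (∂exponents X e) a b c | monoCoeff-zero (∂exponents Y e) a b c
        | monoCoeff-zero (∂exponents Z e) a b c = refl
coeff-unitShifts e ((X , _) ∷ ps) a b c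
  rewrite coeff-unitShifts e ps a b c | monoCoeff-suc (multiplicity X ps) (∂exponents X e) a b c =
  sym (ℤ.+-assoc (monoCoeff (+ 1 , ∂exponents X e) a b c) _ _)
coeff-unitShifts e ((Y , _) ∷ ps) a b c
  rewrite coeff-unitShifts e ps a b c | monoCoeff-suc (multiplicity Y ps) (∂exponents Y e) a b c =
  into-second (monoCoeff (+ 1 , ∂exponents Y e) a b c) (monoCoeff (+ multiplicity X ps , ∂exponents X e) a b c)
    (monoCoeff (+ multiplicity Y ps , ∂exponents Y e) a b c) _
  where
  into-second : ∀ s x y r → s +ℤ (x +ℤ (y +ℤ r)) ≡ x +ℤ ((s +ℤ y) +ℤ r)
  into-second = ℤ-solve-∀
coeff-unitShifts e ((Z , _) ∷ ps) a b c
  rewrite coeff-unitShifts e ps a b c | monoCoeff-suc (multiplicity Z ps) (∂exponents Z e) a b c =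
  into-third (monoCoeff (+ 1 , ∂exponents Z e) a b c) (monoCoeff (+ multiplicity X ps , ∂exponents X e) a b c)
    (monoCoeff (+ multiplicity Y ps , ∂exponents Y e) a b c) (monoCoeff (+ multiplicity Z ps , ∂exponents Z e) a b c) _
  where
  into-third : ∀ s x y z r → s +ℤ (x +ℤ (y +ℤ (z +ℤ r))) ≡ x +ℤ (y +ℤ ((s +ℤ z) +ℤ r))
  into-third = ℤ-solve-∀

Dmono-unit : ∀ a b c → Dmono (+ 1 , a , b , c) ≡ derivativeTerms (λ { X → a ; Y → b ; Z → c }) (a , b , c)
Dmono-unit a b c rewrite ℤ.*-identityˡ (+ a) | ℤ.*-identityˡ (+ b) | ℤ.*-identityˡ (+ c) = refl

coeff-grow : ∀ n t → coeff (map monomial (grow n t)) ≗₃ coeff (Dmono (monomial t))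
coeff-grow n t a b c = begin
  coeff (map monomial (map proj₂ (sites n t))) a b c                  ≡⟨ cong (λ p → coeff p a b c) monomials-sites ⟩
  coeff (map (λ p → + 1 , ∂exponents (proj₁ p) e) (sites n t)) a b c  ≡⟨ coeff-unitShifts e (sites n t) a b c ⟩
  coeff (derivativeTerms (λ v → multiplicity v (sites n t)) e) a b c  ≡⟨ cong (λ p → coeff p a b c) (sym Dmono-monomial) ⟩
  coeff (Dmono (monomial t)) a b c                                    ∎
  where
  open ≡-Reasoning
  e : ℕ × ℕ × ℕ
  e = (ee t , oe t , odd t)
  monomials-sites : map monomial (map proj₂ (sites n t)) ≡ map (λ p → + 1 , ∂exponents (proj₁ p) e) (sites n t)
  monomials-sites = trans (sym (map-∘ (sites n t)))
    (map-cong-local (All.tabulate (λ {(v , g)} v,g∈ → monomial-Grown (∈-sites⁻ t v,g∈))))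
  Dmono-monomial : Dmono (monomial t) ≡ derivativeTerms (λ v → multiplicity v (sites n t)) e
  Dmono-monomial rewrite multiplicity-sites n t X | multiplicity-sites n t Y | multiplicity-sites n t Z =
    Dmono-unit (ee t) (oe t) (odd t)

coeff-S : ∀ m → coeff (S m) ≗₃ coeff (map monomial (trees m))
coeff-S zero a b c = refl
coeff-S (suc m) a b c = begin
  coeff (D (S m)) a b c
    ≡⟨ coeff-D (S m) a b c ⟩
  ∂ (coeff (S m)) a b c
    ≡⟨ ∂-cong (coeff-S m) a b c ⟩
  ∂ (coeff (map monomial (trees m))) a b c
    ≡⟨ sym (coeff-D (map monomial (trees m)) a b c) ⟩
  coeff (D (map monomial (trees m))) a b c
    ≡⟨ cong (λ p → coeff p a b c) (concatMap-map Dmono monomial (trees m)) ⟩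
  coeff (concatMap (Dmono ∘ monomial) (trees m)) a b c
    ≡⟨ sym (coeff-concatMap-cong (coeff-grow (suc m)) (trees m) a b c) ⟩
  coeff (concatMap (map monomial ∘ grow (suc m)) (trees m)) a b c
    ≡⟨ cong (λ p → coeff p a b c) (sym (map-concatMap monomial (grow (suc m)) (trees m))) ⟩
  coeff (map monomial (trees (suc m))) a b c
    ∎
  where open ≡-Reasoning

∈-trees⇔ : ∀ m t → t ∈ trees m ⇔ T (isIncTree m t)
∈-trees⇔ m t = mk⇔
  (λ t∈ → let perm , inc = trees-sound m t∈ in from T-∧ (from (labelsBijective⇔ m t) perm , inc))
  (λ isInc → let bij , inc = to T-∧ isInc in trees-complete m (to (labelsBijective⇔ m t) bij) inc)

hasExponents : ℕ → ℕ → ℕ → Tree → Bool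
hasExponents a b c t = (ee t ≡ᵇ a) ∧ (oe t ≡ᵇ b) ∧ (odd t ≡ᵇ c)

coeff-monomials : ∀ a b c ts → coeff (map monomial ts) a b c ≡ + length (filter (T? ∘ hasExponents a b c) ts)
coeff-monomials a b c [] = refl
coeff-monomials a b c (t ∷ ts) with hasExponents a b c t
... | true = cong (+ 1 +ℤ_) (coeff-monomials a b c ts)
... | false = trans (ℤ.+-identityˡ _) (coeff-monomials a b c ts)

hasExponents⇔ : ∀ a b c t → T (hasExponents a b c t) ⇔ (ee t ≡ a × oe t ≡ b × odd t ≡ c)
hasExponents⇔ a b c t = mk⇔
  (λ h → let ea , rest = to T-∧ h ; eb , ec = to T-∧ rest in ≡ᵇ⇒≡ _ _ ea , ≡ᵇ⇒≡ _ _ eb , ≡ᵇ⇒≡ _ _ ec)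
  (λ (ea , eb , ec) → from T-∧ (≡⇒≡ᵇ _ _ ea , from T-∧ (≡⇒≡ᵇ _ _ eb , ≡⇒≡ᵇ _ _ ec)))

index-∈-lookup : ∀ {A : Set} (xs : List A) i → index (∈-lookup {xs = xs} i) ≡ i
index-∈-lookup (x ∷ xs) Fin.zero = refl
index-∈-lookup (x ∷ xs) (Fin.suc i) = cong Fin.suc (index-∈-lookup xs i)

↔-enumeration : ∀ {A : Set} {P : A → Set} {xs : List A} → Unique xs → (∀ {x} → Irrelevant (P x)) →
                (∀ {x} → x ∈ xs ⇔ P x) → Fin (length xs) ↔ Σ A P
↔-enumeration {A} {P} {xs} unique irrelevant ∈⇔ = mk↔ₛ′ element position element∘position position∘element
  where
  element : Fin (length xs) → Σ A P
  element i = lookup xs i , to ∈⇔ (∈-lookup i)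
  position : Σ A P → Fin (length xs)
  position (x , px) = index (from ∈⇔ px)
  Σ-≡ : ∀ {x y} {px : P x} {py : P y} → x ≡ y → (x , px) ≡ (y , py)
  Σ-≡ refl = cong (_ ,_) (irrelevant _ _)
  element∘position : ∀ p → element (position p) ≡ p
  element∘position (x , px) = Σ-≡ (sym (lookup-index (from ∈⇔ px)))
  position∘element : ∀ i → position (element i) ≡ i
  position∘element i = trans (cong index (unique⇒irrelevant unique _ _)) (index-∈-lookup xs i)

theorem1p6 : (m a b c : ℕ) →
    Σ ℕ (λ k →
      (Fin k ↔ Σ Tree (λ t → T (isIncTree m t) × ee t ≡ a × oe t ≡ b × odd t ≡ c))
      × coeff (S m) a b c ≡ + k)
theorem1p6 m a b c = length matching , ↔-enumeration (UP.filter⁺ _ (trees-unique m)) (λ {t} → irrelevant {t}) ∈⇔ ,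
  trans (coeff-S m a b c) (coeff-monomials a b c (trees m))
  where
  matching : List Tree
  matching = filter (T? ∘ hasExponents a b c) (trees m)
  irrelevant : ∀ {t} → Irrelevant (T (isIncTree m t) × ee t ≡ a × oe t ≡ b × odd t ≡ c)
  irrelevant (i , p , q , r) (i′ , p′ , q′ , r′) = cong₂ _,_ (T-irrelevant i i′)
    (cong₂ _,_ (≡-irrelevant p p′) (cong₂ _,_ (≡-irrelevant q q′) (≡-irrelevant r r′)))
  ∈⇔ : ∀ {t} → t ∈ matching ⇔ (T (isIncTree m t) × ee t ≡ a × oe t ≡ b × odd t ≡ c)
  ∈⇔ {t} = mk⇔
    (λ t∈ → let t∈trees , has = ∈-filter⁻ (T? ∘ hasExponents a b c) t∈ in
      to (∈-trees⇔ m t) t∈trees , to (hasExponents⇔ a b c t) has)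
    (λ (isInc , exps) →
      ∈-filter⁺ (T? ∘ hasExponents a b c) (from (∈-trees⇔ m t) isInc) (from (hasExponents⇔ a b c t) exps))
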